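{- Let $r\le c$ be positive integers. If there exists a resolvable $P_{c\times c}(K_v)$ with $t$ resolution classes, then there exists a resolvable $P_{r\times c}(K_{rv})$ with $2t$ resolution classes.
   Context: For a $w$-set $V$, an $r\times c$ grid-block packing $P_{r\times c}(K_w)$ is a pair $(V,\mathcal A)$ where $\mathcal A$ is a collection of $r\times c$ arrays with entries in $V$ such that any two distinct points of $V$ occur together at most once in the same row or in the same column of arrays in $\mathcal A$. It is resolvable if $\mathcal A$ can be partitioned into resolution classes such that every point of $V$ is contained in precisely one array of each class. -}

module Defs where

open import Data.Nat using (ℕ)
open import Data.Fin using (Fin)
open import Data.Product using (Σ; ∃; ∃-syntax; _×_; _,_)
open import Data.Sum using (_⊎_; inj₁; inj₂)
open import Relation.Binary.PropositionalEquality using (_≡_; _≢_)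

Array : ℕ → ℕ → ℕ → Set
Array r c w = Fin r → Fin c → Fin w

Line : ℕ → ℕ → Set
Line r c = Fin r ⊎ Fin c

InLine : ∀ {r c w} → Array r c w → Line r c → Fin w → Set
InLine A (inj₁ i) x = ∃[ j ] A i j ≡ x
InLine A (inj₂ j) x = ∃[ i ] A i j ≡ x

InArray : ∀ {r c w} → Array r c w → Fin w → Set
InArray A x = ∃[ i ] ∃[ j ] A i j ≡ x

-- The collection of arrays is given already
-- partitioned into its t classes: class i consists of the arrays
-- arr i k, k : Fin (size i).
record ResolvablePacking (r c w t : ℕ) : Set where
  field
    size : Fin t → ℕ
    arr  : (i : Fin t) → Fin (size i) → Array r c w
    distinct : ∀ i k a b a′ b′ → arr i k a b ≡ arr i k a′ b′ → (a ≡ a′) × (b ≡ b′)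
    packing : ∀ (x y : Fin w) → x ≢ y →
      ∀ i k (l : Line r c) i′ k′ (l′ : Line r c) →
      InLine (arr i k) l x → InLine (arr i k) l y →
      InLine (arr i′ k′) l′ x → InLine (arr i′ k′) l′ y →
      _≡_ {A = Σ (Fin t) (λ j → Fin (size j) × Line r c)} (i , k , l) (i′ , k′ , l′)
    cover  : ∀ i (x : Fin w) → ∃[ k ] InArray (arr i k) x
    unique : ∀ i (x : Fin w) k k′ → InArray (arr i k) x → InArray (arr i k′) x → k ≡ k′

module Submission where

-- The new point set Fin (r * v) is read as Fin r × Fin v via 'combine': a
-- point is a pair (layer a, base point x).  Fix a Latin rectangle L with r
-- rows on the symbols Fin c (the first r rows of the cyclic Latin square).
-- A line of an old array, listed as a sequence ℓ of c distinct points, is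
-- "stretched" into the r × c array  (a , b) ↦ (a , ℓ (L a b)):  row a is a
-- copy of the line on layer a, and column b meets every layer once and uses
-- r distinct points of the line.  For each direction s (rows or columns)
-- and each old class i, the stretched lines of direction s of the arrays of
-- class i form a new resolution class, giving 2t classes.  Packing: two
-- distinct points sharing a line of a stretched array have distinct base
-- points lying on the old line, so the packing property of the old design
-- determines the old array and its line; inside one stretched array, which
-- has distinct entries, two points share at most one line.

open import Data.Nat using (ℕ; zero; suc; _+_; _*_; _∸_; _≤_; _%_; NonZero)
open import Data.Nat.Properties using (+-assoc; +-comm; m∸n+n≡m; m+[n∸m]≡n)
open import Data.Nat.DivMod using (_mod_; %-distribˡ-+; m%n%n≡m%n; %-remove-+ˡ; m<n⇒m%n≡m; m%n<n)
open import Data.Nat.Divisibility using (∣-refl)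
open import Data.Fin using (Fin; toℕ; inject≤; combine; remQuot)
open import Data.Fin.Patterns using (0F; 1F)
open import Data.Fin.Properties
  using (toℕ-fromℕ<; toℕ-injective; toℕ<n; toℕ≤n; inject≤-injective; remQuot-combine; combine-remQuot; combine-injective; *↔×)
open import Data.Product using (Σ; ∃-syntax; _×_; _,_; proj₁; proj₂)
open import Data.Product.Properties.WithK using (,-injectiveʳ)
open import Data.Sum using (inj₁; inj₂)
open import Data.Empty using (⊥-elim)
open import Function.Bundles using (_↔_; Inverse; Injection)
open import Function.Definitions using (Injective)
open import Function.Properties.Inverse using (↔⇒↣)
open import Relation.Binary.PropositionalEquality
open import Defs

record LatinRectangle (r c : ℕ) : Set where
  field
    entry           : Fin r → Fin c → Fin c
    rowInjective    : ∀ a {b b′} → entry a b ≡ entry a b′ → b ≡ b′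
    rowSurjective   : ∀ a m → ∃[ b ] entry a b ≡ m
    columnInjective : ∀ b {a a′} → entry a b ≡ entry a′ b → a ≡ a′

module Cyclic (c : ℕ) .{{_ : NonZero c}} where

  %-absorbʳ : ∀ x y → (x + y % c) % c ≡ (x + y) % c
  %-absorbʳ x y = begin
    (x + y % c) % c         ≡⟨ %-distribˡ-+ x (y % c) c ⟩
    (x % c + y % c % c) % c ≡⟨ cong (λ z → (x % c + z) % c) (m%n%n≡m%n y c) ⟩
    (x % c + y % c) % c     ≡⟨ %-distribˡ-+ x y c ⟨
    (x + y) % c             ∎
    where open ≡-Reasoning

  shift : Fin c → Fin c → Fin c
  shift a b = (toℕ a + toℕ b) mod c

  shift-cancel : ∀ {x y} (b : Fin c) → x + y ≡ c → (x + toℕ ((y + toℕ b) mod c)) mod c ≡ b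
  shift-cancel {x} {y} b x+y≡c = toℕ-injective (begin
    toℕ ((x + toℕ ((y + toℕ b) mod c)) mod c) ≡⟨ toℕ-fromℕ< (m%n<n _ c) ⟩
    (x + toℕ ((y + toℕ b) mod c)) % c         ≡⟨ cong (λ z → (x + z) % c) (toℕ-fromℕ< (m%n<n _ c)) ⟩
    (x + (y + toℕ b) % c) % c                 ≡⟨ %-absorbʳ x (y + toℕ b) ⟩
    (x + (y + toℕ b)) % c                     ≡⟨ cong (_% c) (+-assoc x y (toℕ b)) ⟨
    (x + y + toℕ b) % c                       ≡⟨ cong (λ z → (z + toℕ b) % c) x+y≡c ⟩
    (c + toℕ b) % c                           ≡⟨ %-remove-+ˡ (toℕ b) ∣-refl ⟩
    toℕ b % c                                 ≡⟨ m<n⇒m%n≡m (toℕ<n b) ⟩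
    toℕ b                                     ∎)
    where open ≡-Reasoning

  unshift-shift : ∀ a b → (c ∸ toℕ a + toℕ (shift a b)) mod c ≡ b
  unshift-shift a b = shift-cancel b (m∸n+n≡m (toℕ≤n a))

  shift-unshift : ∀ a m → shift a ((c ∸ toℕ a + toℕ m) mod c) ≡ m
  shift-unshift a m = shift-cancel m (m+[n∸m]≡n (toℕ≤n a))

  shift-comm : ∀ a b → shift a b ≡ shift b a
  shift-comm a b = cong (_mod c) (+-comm (toℕ a) (toℕ b))

  -- Rows are injective since shifting is invertible, columns by symmetry.
  square : LatinRectangle c c
  square = record
    { entry           = shift
    ; rowInjective    = rowInjective
    ; rowSurjective   = λ a m → (c ∸ toℕ a + toℕ m) mod c , shift-unshift a m
    ; columnInjective = λ b {a} {a′} e →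
        rowInjective b (trans (shift-comm b a) (trans e (shift-comm a′ b)))
    }
    where
    rowInjective : ∀ a {b b′} → shift a b ≡ shift a b′ → b ≡ b′
    rowInjective a {b} {b′} e =
      trans (sym (unshift-shift a b)) (trans (cong (λ m → (c ∸ toℕ a + toℕ m) mod c) e) (unshift-shift a b′))

cyclicSquare : ∀ c → LatinRectangle c c
cyclicSquare zero    = record
  { entry = λ () ; rowInjective = λ () ; rowSurjective = λ () ; columnInjective = λ () }
cyclicSquare (suc n) = Cyclic.square (suc n)

firstRows : ∀ {r c} → r ≤ c → LatinRectangle c c → LatinRectangle r c
firstRows r≤c L = record
  { entry           = λ a → entry (inject≤ a r≤c)
  ; rowInjective    = λ a → rowInjective (inject≤ a r≤c)
  ; rowSurjective   = λ a → rowSurjective (inject≤ a r≤c)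
  ; columnInjective = λ b e → inject≤-injective r≤c r≤c _ _ (columnInjective b e)
  }
  where open LatinRectangle L

DistinctEntries : ∀ {r c w} → Array r c w → Set
DistinctEntries A = ∀ a b a′ b′ → A a b ≡ A a′ b′ → (a ≡ a′) × (b ≡ b′)

inLine⇒inArray : ∀ {r c w} {A : Array r c w} l {x} → InLine A l x → InArray A x
inLine⇒inArray (inj₁ a) (b , e) = a , b , e
inLine⇒inArray (inj₂ b) (a , e) = a , b , e

-- In an array with distinct entries, two distinct points share at most one
-- line: a row and a column meet in a single cell.
commonLine-unique : ∀ {r c w} {A : Array r c w} {x y} → DistinctEntries A → x ≢ y →
  ∀ l l′ → InLine A l x → InLine A l y → InLine A l′ x → InLine A l′ y → l ≡ l′
commonLine-unique dist x≢y (inj₁ a) (inj₁ a′) (b , ex) _ (b′ , ex′) _ =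
  cong inj₁ (proj₁ (dist a b a′ b′ (trans ex (sym ex′))))
commonLine-unique dist x≢y (inj₂ b) (inj₂ b′) (a , ex) _ (a′ , ex′) _ =
  cong inj₂ (proj₂ (dist a b a′ b′ (trans ex (sym ex′))))
commonLine-unique dist x≢y (inj₁ a) (inj₂ b) (j , ex) (j′ , ey) (i , ex′) (i′ , ey′)
  with refl , refl ← dist a j i b (trans ex (sym ex′))
     | refl , refl ← dist a j′ i′ b (trans ey (sym ey′)) = ⊥-elim (x≢y (trans (sym ex) ey))
commonLine-unique dist x≢y (inj₂ b) (inj₁ a) (i , ex) (i′ , ey) (j , ex′) (j′ , ey′) =
  sym (commonLine-unique dist x≢y (inj₁ a) (inj₂ b) (j , ex′) (j′ , ey′) (i , ex) (i′ , ey))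

module Stretch {r c v : ℕ} (R : LatinRectangle r c) where
  open LatinRectangle R

  layer : Fin (r * v) → Fin r
  layer X = proj₁ (remQuot {r} v X)

  base : Fin (r * v) → Fin v
  base X = proj₂ (remQuot {r} v X)

  base-combine : ∀ a x → base (combine a x) ≡ x
  base-combine a x = cong proj₂ (remQuot-combine {r} {v} a x)

  layer-base : ∀ X → combine (layer X) (base X) ≡ X
  layer-base X = combine-remQuot {r} v X

  combine-base-injective : ∀ {a a′ : Fin r} {x y : Fin v} → base (combine a x) ≡ base (combine a′ y) → x ≡ y
  combine-base-injective {a} {a′} e = trans (sym (base-combine a _)) (trans e (base-combine a′ _))

  stretch : (Fin c → Fin v) → Array r c (r * v)
  stretch ℓ a b = combine a (ℓ (entry a b))

  stretch-distinct : ∀ {ℓ} → Injective _≡_ _≡_ ℓ → DistinctEntries (stretch ℓ)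
  stretch-distinct ℓ-inj a b a′ b′ e with refl , e′ ← combine-injective a _ a′ _ e =
    refl , rowInjective a (ℓ-inj e′)

  stretch-base : ∀ {ℓ X} → InArray (stretch ℓ) X → ∃[ m ] ℓ m ≡ base X
  stretch-base {ℓ} (a , b , refl) = entry a b , sym (base-combine a (ℓ (entry a b)))

  stretch-cover : ∀ {ℓ X} m → ℓ m ≡ base X → InArray (stretch ℓ) X
  stretch-cover {ℓ} {X} m ℓm≡x with b , eb ← rowSurjective (layer X) m =
    layer X , b , trans (cong (λ n → combine (layer X) (ℓ n)) eb)
                        (trans (cong (combine (layer X)) ℓm≡x) (layer-base X))

  -- Distinct points sharing a line of a stretched array have distinct base
  -- points: in a row the layers agree, and a column meets each base point
  -- at most once since the Latin rectangle has distinct column entries.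
  stretch-base-distinct : ∀ {ℓ X Y} → Injective _≡_ _≡_ ℓ → X ≢ Y →
    ∀ l → InLine (stretch ℓ) l X → InLine (stretch ℓ) l Y → base X ≢ base Y
  stretch-base-distinct ℓ-inj X≢Y (inj₁ a) (b , refl) (b′ , refl) e =
    X≢Y (cong (combine a) (combine-base-injective e))
  stretch-base-distinct ℓ-inj X≢Y (inj₂ b) (a , refl) (a′ , refl) e
    with refl ← columnInjective b {a} {a′} (ℓ-inj (combine-base-injective e)) = X≢Y refl

lineOf : ∀ {c} → Fin 2 → Fin c → Line c c
lineOf 0F p = inj₁ p
lineOf 1F p = inj₂ p

pointsOf : ∀ {c w} → Array c c w → Fin 2 → Fin c → Fin c → Fin w
pointsOf M 0F p m = M p m
pointsOf M 1F p m = M m p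

module _ {c w : ℕ} {M : Array c c w} where

  pointsOf-onLine : ∀ s p m → InLine M (lineOf s p) (pointsOf M s p m)
  pointsOf-onLine 0F p m = m , refl
  pointsOf-onLine 1F p m = m , refl

  pointsOf-inArray : ∀ s p m → InArray M (pointsOf M s p m)
  pointsOf-inArray s p m = inLine⇒inArray (lineOf s p) (pointsOf-onLine s p m)

  pointsOf-injective : DistinctEntries M → ∀ s {p p′ m m′} →
    pointsOf M s p m ≡ pointsOf M s p′ m′ → (p ≡ p′) × (m ≡ m′)
  pointsOf-injective dist 0F e = dist _ _ _ _ e
  pointsOf-injective dist 1F e with m≡m′ , p≡p′ ← dist _ _ _ _ e = p≡p′ , m≡m′

  pointsOf-cover : ∀ s {x} → InArray M x → ∃[ p ] ∃[ m ] pointsOf M s p m ≡ x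
  pointsOf-cover 0F (a , b , e) = a , b , e
  pointsOf-cover 1F (a , b , e) = b , a , e

lineOf-injective : ∀ {c} {I : Set} {F : I → Set} {i i′ : I} {k : F i} {k′ : F i′} s s′ {p p′ : Fin c} →
  _≡_ {A = Σ I (λ j → F j × Line c c)} (i , k , lineOf s p) (i′ , k′ , lineOf s′ p′) →
  _≡_ {A = Σ (Fin 2 × I) (λ q → F (proj₂ q) × Fin c)} ((s , i) , k , p) ((s′ , i′) , k′ , p′)
lineOf-injective 0F 0F refl = refl
lineOf-injective 0F 1F ()
lineOf-injective 1F 0F ()
lineOf-injective 1F 1F refl = refl

record IndexedPacking (r c w : ℕ) (Class : Set) (Block : Class → Set) : Set where
  field
    arr      : (q : Class) → Block q → Array r c w
    distinct : ∀ q k → DistinctEntries (arr q k)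
    packing  : ∀ (x y : Fin w) → x ≢ y →
      ∀ q k (l : Line r c) q′ k′ (l′ : Line r c) →
      InLine (arr q k) l x → InLine (arr q k) l y →
      InLine (arr q′ k′) l′ x → InLine (arr q′ k′) l′ y →
      _≡_ {A = Σ Class (λ q → Block q × Line r c)} (q , k , l) (q′ , k′ , l′)
    cover    : ∀ q (x : Fin w) → ∃[ k ] InArray (arr q k) x
    unique   : ∀ q (x : Fin w) k k′ → InArray (arr q k) x → InArray (arr q k′) x → k ≡ k′

enumerate : ∀ {r c w t} {Class : Set} {Block : Class → Set} {count : Class → ℕ} →
  (classes : Fin t ↔ Class) → (blocks : ∀ q → Fin (count q) ↔ Block q) →
  IndexedPacking r c w Class Block → ResolvablePacking r c w t
enumerate {r} {c} {t = t} {Class = Class} {Block} {count} classes blocks P = record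
  { size     = λ j → count (class j)
  ; arr      = λ j k → arr (class j) (block j k)
  ; distinct = λ j k → distinct (class j) (block j k)
  ; packing  = λ x y x≢y j k l j′ k′ l′ hx hy hx′ hy′ →
      index-injective (packing x y x≢y (class j) (block j k) l (class j′) (block j′ k′) l′ hx hy hx′ hy′)
  ; cover    = λ j x → let (k , h) = cover (class j) x in
      from (blocks (class j)) k , subst (λ k → InArray (arr (class j) k) x) (sym (strictlyInverseˡ (blocks (class j)) k)) h
  ; unique   = λ j x k k′ h h′ →
      Injection.injective (↔⇒↣ (blocks (class j))) (unique (class j) x (block j k) (block j k′) h h′)
  }
  where
  open IndexedPacking P
  open Inverse using (to; from; strictlyInverseˡ)

  class : Fin t → Class
  class = to classes

  block : ∀ j → Fin (count (class j)) → Block (class j)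
  block j = to (blocks (class j))

  index-injective : ∀ {j j′ k k′} {l l′ : Line r c} →
    _≡_ {A = Σ Class (λ q → Block q × Line r c)} (class j , block j k , l) (class j′ , block j′ k′ , l′) →
    _≡_ {A = Σ (Fin t) (λ j → Fin (count (class j)) × Line r c)} (j , k , l) (j′ , k′ , l′)
  index-injective e
    with refl ← Injection.injective (↔⇒↣ classes) (cong proj₁ e)
    with refl ← Injection.injective (↔⇒↣ (blocks (class _))) (cong proj₁ (,-injectiveʳ e))
       | refl ← cong proj₂ (,-injectiveʳ e) = refl

module Doubling {r c v t : ℕ} (R : LatinRectangle r c) (P : ResolvablePacking c c v t) where
  open ResolvablePacking P
  open Stretch {v = v} R

  -- A new class is a direction together with an old class; its arrays are
  -- indexed by an old array of that class and a line of that direction.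
  Class : Set
  Class = Fin 2 × Fin t

  Block : Class → Set
  Block q = Fin (size (proj₂ q)) × Fin c

  oldLine : (q : Class) → Block q → Fin c → Fin v
  oldLine (s , i) (k , p) = pointsOf (arr i k) s p

  oldLine-injective : ∀ q k → Injective _≡_ _≡_ (oldLine q k)
  oldLine-injective (s , i) (k , p) e = proj₂ (pointsOf-injective (distinct i k) s e)

  newArr : (q : Class) → Block q → Array r c (r * v)
  newArr q k = stretch (oldLine q k)

  newDistinct : ∀ q k → DistinctEntries (newArr q k)
  newDistinct q k = stretch-distinct (oldLine-injective q k)

  base-onOldLine : ∀ s i k p l {X} → InLine (newArr (s , i) (k , p)) l X →
    InLine (arr i k) (lineOf s p) (base X)
  base-onOldLine s i k p l hX with m , e ← stretch-base (inLine⇒inArray l hX) =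
    subst (InLine (arr i k) (lineOf s p)) e (pointsOf-onLine s p m)

  -- Two distinct points in a common line of two new arrays have distinct
  -- base points, both on the two old lines; the old packing identifies the
  -- old arrays and lines, hence the new arrays, and then the new line.
  newPacking : ∀ X Y → X ≢ Y → ∀ q k l q′ k′ l′ →
    InLine (newArr q k) l X → InLine (newArr q k) l Y →
    InLine (newArr q′ k′) l′ X → InLine (newArr q′ k′) l′ Y →
    _≡_ {A = Σ Class (λ q → Block q × Line r c)} (q , k , l) (q′ , k′ , l′)
  newPacking X Y X≢Y (s , i) (k , p) l (s′ , i′) (k′ , p′) l′ hX hY hX′ hY′
    with refl ← lineOf-injective s s′ (packing (base X) (base Y)
                  (stretch-base-distinct (oldLine-injective (s , i) (k , p)) X≢Y l hX hY)
                  i k (lineOf s p) i′ k′ (lineOf s′ p′)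
                  (base-onOldLine s i k p l hX) (base-onOldLine s i k p l hY)
                  (base-onOldLine s′ i′ k′ p′ l′ hX′) (base-onOldLine s′ i′ k′ p′ l′ hY′)) =
    cong (λ l → (s , i) , (k , p) , l) (commonLine-unique (newDistinct (s , i) (k , p)) X≢Y l l′ hX hY hX′ hY′)

  -- Each base point lies on exactly one line of direction s of exactly one
  -- old array of class i.
  newCover : ∀ q X → ∃[ k ] InArray (newArr q k) X
  newCover (s , i) X with k , hx ← cover i (base X) with p , m , e ← pointsOf-cover s hx =
    (k , p) , stretch-cover m e

  newUnique : ∀ q X k k′ → InArray (newArr q k) X → InArray (newArr q k′) X → k ≡ k′
  newUnique (s , i) X (k , p) (k′ , p′) h h′
    with m , e ← stretch-base h | m′ , e′ ← stretch-base h′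
    with refl ← unique i (base X) k k′ (subst (InArray (arr i k)) e (pointsOf-inArray s p m))
                                      (subst (InArray (arr i k′)) e′ (pointsOf-inArray s p′ m′))
    with refl , _ ← pointsOf-injective (distinct i k) s (trans e (sym e′)) = refl

  doubled : IndexedPacking r c (r * v) Class Block
  doubled = record
    { arr      = newArr
    ; distinct = newDistinct
    ; packing  = newPacking
    ; cover    = newCover
    ; unique   = newUnique
    }

mainTheorem8 : (r c v t : ℕ) → 1 ≤ r → r ≤ c →
    ResolvablePacking c c v t → ResolvablePacking r c (r * v) (2 * t)
mainTheorem8 r c v t _ r≤c P =
  enumerate *↔× (λ _ → *↔×) (Doubling.doubled (firstRows r≤c (cyclicSquare c)) P)
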